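{- Let $n\ge1$. For every $\sigma\in\mathrm{Sym}(n+1)$, the equality of $(n+1)\times(n+1)$ matrices over $\mathbb{Z}/2\mathbb{Z}$ $$T\cdot Q(\sigma)=P(\sigma)\cdot T$$ holds.
   Context: $\mathrm{Sym}(n+1)$ is the group of bijections of $\{1,\dots,n+1\}$ with product $\sigma\cdot\rho:=\rho\circ\sigma$; $(i\ j)$ is a transposition. $\delta_{i,j}\in\mathbb{Z}/2\mathbb{Z}$ is the Kronecker delta; all arithmetic is in $\mathbb{Z}/2\mathbb{Z}$. Define matrices indexed by $i,j\in\{1,\dots,n+1\}$: $P(\sigma)_{i,j}=\delta_{\sigma(i),j}$; $T_{i,j}=\delta_{i,j}+\delta_{j,n+1}(1+\delta_{i,n+1})$; and $Q(\sigma)_{i,j}=\delta_{(n+1\ \sigma(n+1))(\sigma(i)),\,j}+\delta_{\sigma(n+1),j}(1+\delta_{n+1,\sigma(i)})(1+\delta_{\sigma(n+1),n+1})$, where $(n+1\ \sigma(n+1))$ is the identity when $\sigma(n+1)=n+1$. -}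

module Defs where

open import Data.Nat using (ℕ; suc)
open import Data.Bool using (Bool; true; false; _xor_; _∧_; not)
open import Data.Fin using (Fin; fromℕ; _≟_)
open import Data.Fin.Permutation using (Permutation′; _⟨$⟩ʳ_; transpose)
open import Relation.Nullary.Decidable using (⌊_⌋)

-- Z/2Z is modelled by Bool: addition = xor, multiplication = ∧.
𝔽₂ : Set
𝔽₂ = Bool

-- Square matrices indexed by Fin m (indices 1..n+1 correspond to Fin (suc n),
-- with n+1 ↔ fromℕ n, the last index).
Mat : ℕ → Set
Mat m = Fin m → Fin m → 𝔽₂

Σ₂ : ∀ {m} → (Fin m → 𝔽₂) → 𝔽₂
Σ₂ {ℕ.zero} f = false
Σ₂ {suc m} f = f Fin.zero xor Σ₂ (λ i → f (Fin.suc i))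

_·ᴹ_ : ∀ {m} → Mat m → Mat m → Mat m
(A ·ᴹ B) i j = Σ₂ (λ k → A i k ∧ B k j)

δ : ∀ {m} → Fin m → Fin m → 𝔽₂
δ i j = ⌊ i ≟ j ⌋

Sym : ℕ → Set
Sym n = Permutation′ (suc n)

last : ∀ n → Fin (suc n)
last n = fromℕ n

P : ∀ n → Sym n → Mat (suc n)
P n σ i j = δ (σ ⟨$⟩ʳ i) j

T : ∀ n → Mat (suc n)
T n i j = δ i j xor (δ j (last n) ∧ not (δ i (last n)))

-- Q(σ)_{i,j} = δ_{(n+1 σ(n+1))(σ(i)), j}
--              + δ_{σ(n+1),j}(1 + δ_{n+1,σ(i)})(1 + δ_{σ(n+1),n+1})
-- (transpose a a is the identity permutation)
Q : ∀ n → Sym n → Mat (suc n)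
Q n σ i j =
  δ (transpose (last n) (σ ⟨$⟩ʳ last n) ⟨$⟩ʳ (σ ⟨$⟩ʳ i)) j
  xor (δ (σ ⟨$⟩ʳ last n) j ∧ (not (δ (last n) (σ ⟨$⟩ʳ i)) ∧ not (δ (σ ⟨$⟩ʳ last n) (last n))))

module Submission where

-- Over 𝔽₂, T = I + Σ_{i ≠ n+1} e_i e_{n+1}ᵀ, so left multiplication by T adds row n+1 to
-- every other row, while P(σ) sends row i to row σ(i).  The claim thus reads
-- Q_i + [i ≠ n+1] Q_{n+1} = T_{σ(i)}.  Put s = σ(n+1), x = σ(i) (so i ≠ n+1 iff x ≠ s) and
-- write the permutation matrix of the transposition (n+1 s) as I + v vᵀ with v = e_{n+1} + e_s.
-- Both sides become polynomials in Kronecker deltas whose difference is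
-- δ_{s,j} δ_{s,n+1} (δ_{x,n+1} + δ_{x,s}), and this vanishes since s = n+1 forces the bracket to 0.

open import Defs
open import Data.Nat using (ℕ; zero; suc; _≤_)
open import Relation.Binary.PropositionalEquality
  using (_≡_; refl; sym; trans; cong; cong₂; module ≡-Reasoning)
open import Data.Bool using (true; false; _xor_; _∧_; not)
open import Data.Bool.Properties
  using (xor-identityʳ; xor-same; xor-assoc; xor-comm; ∧-distribʳ-xor; ∧-assoc; ∧-idem; ∧-zeroʳ)
open import Data.Bool.Solver using (module xor-∧-Solver)
open import Data.Fin using (Fin; zero; suc; _≟_)
open import Data.Fin.Properties using (suc-injective)
open import Data.Fin.Permutation using (Permutation′; _⟨$⟩ʳ_)
import Data.Fin.Permutation.Components as PC
open import Function using (_∘_; Injection; mk⇔; _⇔_)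
open import Function.Properties.Inverse using (↔⇒↣)
open import Relation.Nullary using (¬_; yes; no)
open import Relation.Nullary.Decidable using (isYes≗does; dec-true; dec-false; does-⇔)

private
  variable
    m : ℕ

xor-cancelˡ : ∀ a b → a xor (a xor b) ≡ b
xor-cancelˡ a b = trans (sym (xor-assoc a a b)) (cong (_xor b) (xor-same a))

Σ₂-cong : {f g : Fin m → 𝔽₂} → (∀ k → f k ≡ g k) → Σ₂ f ≡ Σ₂ g
Σ₂-cong {zero}  f≗g = refl
Σ₂-cong {suc m} f≗g = cong₂ _xor_ (f≗g zero) (Σ₂-cong (f≗g ∘ suc))

Σ₂-xor : (f g : Fin m → 𝔽₂) → Σ₂ (λ k → f k xor g k) ≡ Σ₂ f xor Σ₂ g
Σ₂-xor {zero}  f g = refl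
Σ₂-xor {suc m} f g = trans (cong ((f zero xor g zero) xor_) (Σ₂-xor (f ∘ suc) (g ∘ suc)))
  (solve 4 (λ a b c d → (a :+ b) :+ (c :+ d) := (a :+ c) :+ (b :+ d)) refl
    (f zero) (g zero) (Σ₂ (f ∘ suc)) (Σ₂ (g ∘ suc)))
  where open xor-∧-Solver

Σ₂-zero : {f : Fin m → 𝔽₂} → (∀ k → f k ≡ false) → Σ₂ f ≡ false
Σ₂-zero {zero}  f≗0 = refl
Σ₂-zero {suc m} f≗0 = cong₂ _xor_ (f≗0 zero) (Σ₂-zero (f≗0 ∘ suc))

Σ₂-single : {f : Fin m → 𝔽₂} (a : Fin m) → (∀ k → ¬ k ≡ a → f k ≡ false) → Σ₂ f ≡ f a
Σ₂-single {f = f} zero    f≗0 =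
  trans (cong (f zero xor_) (Σ₂-zero (λ k → f≗0 (suc k) λ ()))) (xor-identityʳ (f zero))
Σ₂-single {f = f} (suc a) f≗0 =
  trans (cong (_xor Σ₂ (f ∘ suc)) (f≗0 zero λ ()))
        (Σ₂-single a (λ k k≢a → f≗0 (suc k) (k≢a ∘ suc-injective)))

δ-≡ : {a b : Fin m} → a ≡ b → δ a b ≡ true
δ-≡ {a = a} {b} a≡b = trans (isYes≗does (a ≟ b)) (dec-true (a ≟ b) a≡b)

δ-≢ : {a b : Fin m} → ¬ a ≡ b → δ a b ≡ false
δ-≢ {a = a} {b} a≢b = trans (isYes≗does (a ≟ b)) (dec-false (a ≟ b) a≢b)

δ-⇔ : {a b c d : Fin m} → (a ≡ b ⇔ c ≡ d) → δ a b ≡ δ c d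
δ-⇔ {a = a} {b} {c} {d} a≡b⇔c≡d =
  trans (isYes≗does (a ≟ b)) (trans (does-⇔ a≡b⇔c≡d (a ≟ b) (c ≟ d)) (sym (isYes≗does (c ≟ d))))

δ-sym : (a b : Fin m) → δ a b ≡ δ b a
δ-sym a b = δ-⇔ (mk⇔ sym sym)

δ-permute : (σ : Permutation′ m) (a b : Fin m) → δ (σ ⟨$⟩ʳ a) (σ ⟨$⟩ʳ b) ≡ δ a b
δ-permute σ a b = δ-⇔ (mk⇔ (Injection.injective (↔⇒↣ σ)) (cong (σ ⟨$⟩ʳ_)))

Σ₂-δ : (a : Fin m) (f : Fin m → 𝔽₂) → Σ₂ (λ k → δ a k ∧ f k) ≡ f a
Σ₂-δ a f = trans (Σ₂-single a (λ k k≢a → cong (_∧ f k) (δ-≢ (k≢a ∘ sym))))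
                 (cong (_∧ f a) (δ-≡ refl))

transpose-matchˡ : (i j : Fin m) → PC.transpose i j i ≡ j
transpose-matchˡ i j rewrite dec-true (i ≟ i) refl = refl

transpose-matchʳ : (i j : Fin m) → PC.transpose i j j ≡ i
transpose-matchʳ i j with i ≟ j
... | yes refl = transpose-matchˡ i i
... | no i≢j rewrite dec-false (j ≟ i) (i≢j ∘ sym) | dec-true (j ≟ j) refl = refl

δ-transpose : (L s x j : Fin m) →
  δ (PC.transpose L s x) j ≡ δ x j xor ((δ x L xor δ x s) ∧ (δ L j xor δ s j))
-- Matching on x ≟ L also decides the first test inside PC.transpose; the second is rewritten.
δ-transpose L s x j with x ≟ L | x ≟ s
... | yes refl | yes refl = sym (xor-identityʳ (δ L j))
... | yes refl | no _     = sym (xor-cancelˡ (δ L j) (δ s j))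
... | no _     | yes refl rewrite dec-true (s ≟ s) refl =
  sym (trans (cong (δ s j xor_) (xor-comm (δ L j) (δ s j))) (xor-cancelˡ (δ s j) (δ L j)))
... | no _     | no x≢s   rewrite dec-false (x ≟ s) x≢s = sym (xor-identityʳ (δ x j))

δ-separation : (L s x : Fin m) → δ s L ∧ (δ x L xor δ x s) ≡ false
δ-separation L s x with s ≟ L
... | yes refl = xor-same (δ x s)
... | no _     = refl

P-·ᴹ : (n : ℕ) (σ : Sym n) (A : Mat (suc n)) (i j : Fin (suc n)) →
  (P n σ ·ᴹ A) i j ≡ A (σ ⟨$⟩ʳ i) j
P-·ᴹ n σ A i j = Σ₂-δ (σ ⟨$⟩ʳ i) (λ k → A k j)

T-·ᴹ : (n : ℕ) (A : Mat (suc n)) (i j : Fin (suc n)) →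
  (T n ·ᴹ A) i j ≡ A i j xor (not (δ i (last n)) ∧ A (last n) j)
T-·ᴹ n A i j = begin
  Σ₂ (λ k → (δ i k xor (δ k L ∧ c)) ∧ A k j)
    ≡⟨ Σ₂-cong split ⟩
  Σ₂ (λ k → (δ i k ∧ A k j) xor (δ L k ∧ (c ∧ A k j)))
    ≡⟨ Σ₂-xor (λ k → δ i k ∧ A k j) (λ k → δ L k ∧ (c ∧ A k j)) ⟩
  Σ₂ (λ k → δ i k ∧ A k j) xor Σ₂ (λ k → δ L k ∧ (c ∧ A k j))
    ≡⟨ cong₂ _xor_ (Σ₂-δ i (λ k → A k j)) (Σ₂-δ L (λ k → c ∧ A k j)) ⟩
  A i j xor (c ∧ A L j) ∎
  where
  open ≡-Reasoning
  L : Fin (suc n)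
  L = last n
  c : 𝔽₂
  c = not (δ i L)
  split : ∀ k → (δ i k xor (δ k L ∧ c)) ∧ A k j ≡ (δ i k ∧ A k j) xor (δ L k ∧ (c ∧ A k j))
  split k = begin
    (δ i k xor (δ k L ∧ c)) ∧ A k j           ≡⟨ ∧-distribʳ-xor (A k j) (δ i k) (δ k L ∧ c) ⟩
    (δ i k ∧ A k j) xor ((δ k L ∧ c) ∧ A k j) ≡⟨ cong (δ i k ∧ A k j xor_) (∧-assoc (δ k L) c (A k j)) ⟩
    (δ i k ∧ A k j) xor (δ k L ∧ (c ∧ A k j)) ≡⟨ cong (λ d → δ i k ∧ A k j xor d ∧ c ∧ A k j) (δ-sym k L) ⟩
    (δ i k ∧ A k j) xor (δ L k ∧ (c ∧ A k j)) ∎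

-- Q n σ i j is definitionally Q-row (last n) (σ ⟨$⟩ʳ last n) (σ ⟨$⟩ʳ i) j.
Q-row : Fin m → Fin m → Fin m → Fin m → 𝔽₂
Q-row L s x j = δ (PC.transpose L s x) j xor (δ s j ∧ (not (δ L x) ∧ not (δ s L)))

Q-row-expand : (L s x j : Fin m) → Q-row L s x j ≡
  (δ x j xor ((δ x L xor δ x s) ∧ (δ L j xor δ s j))) xor (δ s j ∧ (not (δ x L) ∧ not (δ s L)))
Q-row-expand L s x j =
  cong₂ (λ t u → t xor (δ s j ∧ (not u ∧ not (δ s L)))) (δ-transpose L s x j) (δ-sym L x)

Q-row-at : (L s j : Fin m) → Q-row L s s j ≡ δ L j xor (δ s j ∧ not (δ s L))
Q-row-at L s j = cong₂ (λ t u → δ t j xor (δ s j ∧ u)) (transpose-matchʳ L s)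
  (trans (cong (λ u → not u ∧ not (δ s L)) (δ-sym L s)) (∧-idem (not (δ s L))))

Q-row-polynomial : ∀ X S Lj a b c →
  ((X xor ((a xor b) ∧ (Lj xor S))) xor (S ∧ (not a ∧ not c))) xor (not b ∧ (Lj xor (S ∧ not c)))
    ≡ (X xor (Lj ∧ not a)) xor (S ∧ (c ∧ (a xor b)))
-- not p is definitionally true xor p, so it is given to the solver as con true :+ p.
Q-row-polynomial = solve 6 (λ X S Lj a b c →
  ((X :+ ((a :+ b) :* (Lj :+ S))) :+ (S :* ((con true :+ a) :* (con true :+ c))))
    :+ ((con true :+ b) :* (Lj :+ (S :* (con true :+ c))))
  := (X :+ (Lj :* (con true :+ a))) :+ (S :* (c :* (a :+ b)))) refl
  where open xor-∧-Solver

Q-row-correction : (L s x j : Fin m) →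
  Q-row L s x j xor (not (δ x s) ∧ Q-row L s s j) ≡ δ x j xor (δ j L ∧ not (δ x L))
Q-row-correction L s x j = begin
  Q-row L s x j xor (not b ∧ Q-row L s s j)
    ≡⟨ cong₂ (λ q r → q xor (not b ∧ r)) (Q-row-expand L s x j) (Q-row-at L s j) ⟩
  ((X xor ((a xor b) ∧ (Lj xor S))) xor (S ∧ (not a ∧ not c))) xor (not b ∧ (Lj xor (S ∧ not c)))
    ≡⟨ Q-row-polynomial X S Lj a b c ⟩
  (X xor (Lj ∧ not a)) xor (S ∧ (c ∧ (a xor b)))
    ≡⟨ cong (λ z → (X xor (Lj ∧ not a)) xor (S ∧ z)) (δ-separation L s x) ⟩
  (X xor (Lj ∧ not a)) xor (S ∧ false)
    ≡⟨ trans (cong ((X xor (Lj ∧ not a)) xor_) (∧-zeroʳ S)) (xor-identityʳ (X xor (Lj ∧ not a))) ⟩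
  X xor (Lj ∧ not a)
    ≡⟨ cong (λ z → X xor (z ∧ not a)) (δ-sym L j) ⟩
  X xor (δ j L ∧ not a) ∎
  where
  open ≡-Reasoning
  X S Lj a b c : 𝔽₂
  X = δ x j
  S = δ s j
  Lj = δ L j
  a = δ x L
  b = δ x s
  c = δ s L

mainTheorem3 : (n : ℕ) → 1 ≤ n → (σ : Sym n) →
    ∀ i j → (T n ·ᴹ Q n σ) i j ≡ (P n σ ·ᴹ T n) i j
mainTheorem3 n _ σ i j = begin
  (T n ·ᴹ Q n σ) i j
    ≡⟨ T-·ᴹ n (Q n σ) i j ⟩
  Q n σ i j xor (not (δ i L) ∧ Q n σ L j)
    ≡⟨ cong (λ b → Q n σ i j xor (not b ∧ Q n σ L j)) (sym (δ-permute σ i L)) ⟩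
  Q-row L s x j xor (not (δ x s) ∧ Q-row L s s j)
    ≡⟨ Q-row-correction L s x j ⟩
  T n x j
    ≡⟨ sym (P-·ᴹ n σ (T n) i j) ⟩
  (P n σ ·ᴹ T n) i j ∎
  where
  open ≡-Reasoning
  L s x : Fin (suc n)
  L = last n
  s = σ ⟨$⟩ʳ L
  x = σ ⟨$⟩ʳ i
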